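{- Let $x,y$ be indeterminates over $\mathbb F_q$. For all integers $d\ge1$, \[\sum_{j=0}^{d-1}\ell_j(x)^{ -1}\prod_{k=0}^{j-1}(y-x^{q^k})=\ell_{d-1}(x)^{ -1}\prod_{j=1}^{d-1}(y-x^{q^j}).\]
   Context: $\ell_0=1$ and $\ell_j=(\theta-\theta^{q^j})\ell_{j-1}\in\mathbb F_q[\theta]$ for $j\ge1$; $\ell_j(x)\in\mathbb F_q[x]$ is the image of $\ell_j$ under $\theta\mapsto x$, i.e. $\ell_j(x)=\prod_{i=1}^j(x-x^{q^i})$. Empty products equal $1$. -}

module Defs where

open import Level using (Level)
open import Data.Nat using (ℕ; zero; suc)
import Data.Nat as N
open import Algebra.Bundles using (CommutativeRing)

module _ {c ℓ : Level} (R : CommutativeRing c ℓ) where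
  open CommutativeRing R

  pow : Carrier → ℕ → Carrier
  pow a zero    = 1#
  pow a (suc n) = pow a n * a

  frob : ℕ → Carrier → ℕ → Carrier
  frob q x i = pow x (q N.^ i)

  ell : ℕ → Carrier → ℕ → Carrier
  ell q x zero    = 1#
  ell q x (suc j) = (x - frob q x (suc j)) * ell q x j

  prodFrom0 : ℕ → Carrier → Carrier → ℕ → Carrier
  prodFrom0 q x y zero    = 1#
  prodFrom0 q x y (suc j) = prodFrom0 q x y j * (y - frob q x j)

  prodFrom1 : ℕ → Carrier → Carrier → ℕ → Carrier
  prodFrom1 q x y zero    = 1#
  prodFrom1 q x y (suc j) = prodFrom1 q x y j * (y - frob q x (suc j))

  sumBelow : ℕ → (ℕ → Carrier) → Carrier
  sumBelow zero    f = 0#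
  sumBelow (suc n) f = sumBelow n f + f n

{-# OPTIONS --safe #-}
module Submission where

-- Since ℓ_{n+1} = (x - x^{q^{n+1}}) ℓ_n, we have
-- ℓ_n⁻¹ = (x - x^{q^{n+1}}) ℓ_{n+1}⁻¹, and the new summand is
-- ℓ_{n+1}⁻¹ (y - x) ∏_{k=1}^{n} (y - x^{q^k}). Adding it to the inductive value
-- ℓ_n⁻¹ ∏_{k=1}^{n} (y - x^{q^k}) gives ℓ_{n+1}⁻¹ ∏_{k=1}^{n} (y - x^{q^k})
-- times (x - x^{q^{n+1}}) + (y - x) = y - x^{q^{n+1}}: the sum telescopes.

open import Defs
open import Level using (Level)
open import Data.Nat using (ℕ; _≤_; _<_; _∸_; zero; suc)
open import Data.Nat.Properties using (≤-refl; n<1+n; m<n⇒m<1+n)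
open import Algebra.Bundles using (CommutativeRing)
import Algebra.Properties.CommutativeSemigroup as CommSemigroupProperties
import Relation.Binary.Reasoning.Setoid as SetoidReasoning

module _ {c ℓ : Level} (R : CommutativeRing c ℓ) where
  open CommutativeRing R
  open CommSemigroupProperties *-commutativeSemigroup using (xy∙z≈y∙xz; x∙yz≈yx∙z)
  open SetoidReasoning setoid

  x-y+y-z≈x-z : ∀ a b c → (a - b) + (b - c) ≈ a - c
  x-y+y-z≈x-z a b c = begin
    (a - b) + (b - c)     ≈⟨ +-assoc a (- b) (b - c) ⟩
    a + (- b + (b - c))   ≈⟨ +-congˡ (sym (+-assoc (- b) b (- c))) ⟩
    a + ((- b + b) - c)   ≈⟨ +-congˡ (+-congʳ (-‿inverseˡ b)) ⟩
    a + (0# - c)          ≈⟨ +-congˡ (+-identityˡ (- c)) ⟩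
    a - c                 ∎

  y*u≈1⇒x*y*v≈1⇒u≈x*v : ∀ {a b u v} → b * u ≈ 1# → (a * b) * v ≈ 1# → u ≈ a * v
  y*u≈1⇒x*y*v≈1⇒u≈x*v {a} {b} {u} {v} bu≈1 abv≈1 = begin
    u                     ≈⟨ *-identityʳ u ⟨
    u * 1#                ≈⟨ *-congˡ abv≈1 ⟨
    u * ((a * b) * v)     ≈⟨ *-congˡ (xy∙z≈y∙xz a b v) ⟩
    u * (b * (a * v))     ≈⟨ x∙yz≈yx∙z u b (a * v) ⟩
    (b * u) * (a * v)     ≈⟨ *-congʳ bu≈1 ⟩
    1# * (a * v)          ≈⟨ *-identityˡ (a * v) ⟩
    a * v                 ∎

  module _ (q : ℕ) (x y : Carrier) where

    prodFrom0-suc : ∀ j → prodFrom0 R q x y (suc j) ≈ (y - x) * prodFrom1 R q x y j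
    prodFrom0-suc zero    = begin
      1# * (y - pow R x 1)  ≈⟨ *-identityˡ _ ⟩
      y - pow R x 1         ≈⟨ +-congˡ (-‿cong (*-identityˡ x)) ⟩
      y - x                 ≈⟨ *-identityʳ (y - x) ⟨
      (y - x) * 1#          ∎
    prodFrom0-suc (suc j) = trans (*-congʳ (prodFrom0-suc j)) (*-assoc _ _ _)

    sumBelow-prodFrom0 : (ellInv : ℕ → Carrier) → ∀ n →
      (∀ j → j < suc n → ell R q x j * ellInv j ≈ 1#) →
      sumBelow R (suc n) (λ j → ellInv j * prodFrom0 R q x y j)
        ≈ ellInv n * prodFrom1 R q x y n
    sumBelow-prodFrom0 e zero    _   = +-identityˡ _
    sumBelow-prodFrom0 e (suc n) inv = begin
      sumBelow R (suc n) term + e′ * prodFrom0 R q x y (suc n)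
        ≈⟨ +-cong (sumBelow-prodFrom0 e n (λ j j<1+n → inv j (m<n⇒m<1+n j<1+n)))
                  (*-congˡ (prodFrom0-suc n)) ⟩
      e n * P + e′ * ((y - x) * P)
        ≈⟨ +-congʳ (*-congʳ eₙ≈[x-f]e′) ⟩
      ((x - f) * e′) * P + e′ * ((y - x) * P)
        ≈⟨ +-congʳ (xy∙z≈y∙xz (x - f) e′ P) ⟩
      e′ * ((x - f) * P) + e′ * ((y - x) * P)
        ≈⟨ distribˡ e′ _ _ ⟨
      e′ * ((x - f) * P + (y - x) * P)
        ≈⟨ *-congˡ (distribʳ P (x - f) (y - x)) ⟨
      e′ * (((x - f) + (y - x)) * P)
        ≈⟨ *-congˡ (*-congʳ (trans (+-comm (x - f) (y - x)) (x-y+y-z≈x-z y x f))) ⟩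
      e′ * ((y - f) * P)
        ≈⟨ *-congˡ (*-comm (y - f) P) ⟩
      e′ * (P * (y - f))
        ∎
      where
      term : ℕ → Carrier
      term j = e j * prodFrom0 R q x y j
      e′ f P : Carrier
      e′ = e (suc n)
      f  = frob R q x (suc n)
      P  = prodFrom1 R q x y n
      eₙ≈[x-f]e′ : e n ≈ (x - f) * e′
      eₙ≈[x-f]e′ = y*u≈1⇒x*y*v≈1⇒u≈x*v (inv n (m<n⇒m<1+n (n<1+n n))) (inv (suc n) ≤-refl)

lemma9 : {c ℓ : Level} (R : CommutativeRing c ℓ) (q d : ℕ) → 1 ≤ d →
         let open CommutativeRing R in
         (x y : Carrier) (ellInv : ℕ → Carrier) →
         (∀ j → j < d → ell R q x j * ellInv j ≈ 1#) →
         sumBelow R d (λ j → ellInv j * prodFrom0 R q x y j)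
           ≈ ellInv (d ∸ 1) * prodFrom1 R q x y (d ∸ 1)
lemma9 R q (suc n) _ x y ellInv inv = sumBelow-prodFrom0 R q x y ellInv n inv
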